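{- Let $H$ be an $(8,3)$-bigraph with no 1-factor. Then either (a) $H$ contains an obstruction having type 1 or type 2 and $\mathrm{swap}(H)$ also contains an obstruction of the same type, or (b) at least one of $H$ and $\mathrm{swap}(H)$ contains an obstruction having type 3 or type 4.
   Context: A bigraph is a bipartite graph with parts $A$ and $B$ such that $|A|=|B|$; an $(s,t)$-bigraph is a bigraph with $|A|=|B|=s$ and minimum degree at least $t$. $\mathrm{swap}(H)$ denotes the same bigraph with the names of the parts $A$ and $B$ interchanged. In an $(8,3)$-bigraph $H$, an obstruction is a set $X\subseteq A$ with $|N(X)|<|X|$. An obstruction $X$ has type 1 if $|X|=5$ and $|N(X)|=3$; type 2 if $|X|=4$, $|N(X)|=3$, and there exist $x_1\in A\setminus X$ and an edge $e_1$ incident with $x_1$ such that $|N_H(X\cup\{x_1\})|=4$ but $|N_{H-e_1}(X\cup\{x_1\})|=3$; type 3 if $|X|=4$, $|N(X)|=3$, and there exist $x_1\in A\setminus X$ and edges $e_1,e_2$ incident with $x_1$ such that $|N_H(X\cup\{x_1\})|=5$ but $|N_{H-\{e_1,e_2\}}(X\cup\{x_1\})|=3$; and type 4 if $|X|=4$, $|N(X)|=3$, but $X$ is not a subset of any obstruction having type 1, 2, or 3. -}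

module Defs where

open import Data.Nat using (ℕ; _≥_; _<_)
open import Data.Bool using (Bool; true; false; _∧_; not)
open import Data.Fin using (Fin)
open import Data.Fin.Properties using (_≟_)
open import Data.Fin.Subset using (Subset; ∣_∣; _∪_; ⁅_⁆; _∉_; _⊆_)
open import Data.Vec using (tabulate; lookup; foldr)
open import Data.Bool using (_∨_)
open import Data.Product using (Σ; ∃; _×_; _,_)
open import Data.Sum using (_⊎_)
open import Relation.Nullary using (¬_)
open import Relation.Nullary.Decidable using (⌊_⌋)
open import Relation.Binary.PropositionalEquality using (_≡_; _≢_)
open import Function.Definitions using (Injective)

-- A bigraph with parts A = Fin n and B = Fin n, given by its (simple)
-- biadjacency relation: H a b ≡ true iff a ∈ A is adjacent to b ∈ B.
Bigraph : ℕ → Set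
Bigraph n = Fin n → Fin n → Bool

swap : ∀ {n} → Bigraph n → Bigraph n
swap H a b = H b a

degA : ∀ {n} → Bigraph n → Fin n → ℕ
degA H a = ∣ tabulate (λ b → H a b) ∣

degB : ∀ {n} → Bigraph n → Fin n → ℕ
degB H b = ∣ tabulate (λ a → H a b) ∣

-- (s,t)-bigraph: |A| = |B| = s (built into the type) and minimum degree ≥ t
IsSTBigraph : (s t : ℕ) → Bigraph s → Set
IsSTBigraph s t H = (∀ a → degA H a ≥ t) × (∀ b → degB H b ≥ t)

HasOneFactor : ∀ {n} → Bigraph n → Set
HasOneFactor {n} H =
  Σ (Fin n → Fin n) (λ f → Injective _≡_ _≡_ f × (∀ a → H a (f a) ≡ true))

N : ∀ {n} → Bigraph n → Subset n → Subset n
N H X = tabulate (λ b → foldr _ _∨_ false (tabulate (λ a → lookup X a ∧ H a b)))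

removeEdge : ∀ {n} → Bigraph n → Fin n → Fin n → Bigraph n
removeEdge H a₀ b₀ a b = H a b ∧ not (⌊ a ≟ a₀ ⌋ ∧ ⌊ b ≟ b₀ ⌋)

IsObstruction : ∀ {n} → Bigraph n → Subset n → Set
IsObstruction H X = ∣ N H X ∣ < ∣ X ∣

Type1 : ∀ {n} → Bigraph n → Subset n → Set
Type1 H X = IsObstruction H X × ∣ X ∣ ≡ 5 × ∣ N H X ∣ ≡ 3

Type2 : ∀ {n} → Bigraph n → Subset n → Set
Type2 {n} H X = IsObstruction H X × ∣ X ∣ ≡ 4 × ∣ N H X ∣ ≡ 3 ×
  Σ (Fin n) (λ x₁ → x₁ ∉ X × Σ (Fin n) (λ b₁ → H x₁ b₁ ≡ true ×
     ∣ N H (X ∪ ⁅ x₁ ⁆) ∣ ≡ 4 ×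
     ∣ N (removeEdge H x₁ b₁) (X ∪ ⁅ x₁ ⁆) ∣ ≡ 3))

Type3 : ∀ {n} → Bigraph n → Subset n → Set
Type3 {n} H X = IsObstruction H X × ∣ X ∣ ≡ 4 × ∣ N H X ∣ ≡ 3 ×
  Σ (Fin n) (λ x₁ → x₁ ∉ X × Σ (Fin n) (λ b₁ → Σ (Fin n) (λ b₂ →
     b₁ ≢ b₂ × H x₁ b₁ ≡ true × H x₁ b₂ ≡ true ×
     ∣ N H (X ∪ ⁅ x₁ ⁆) ∣ ≡ 5 ×
     ∣ N (removeEdge (removeEdge H x₁ b₁) x₁ b₂) (X ∪ ⁅ x₁ ⁆) ∣ ≡ 3)))

Type4 : ∀ {n} → Bigraph n → Subset n → Set
Type4 H X = IsObstruction H X × ∣ X ∣ ≡ 4 × ∣ N H X ∣ ≡ 3 ×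
  (∀ Y → X ⊆ Y → ¬ (Type1 H Y ⊎ Type2 H Y ⊎ Type3 H Y))

Contains : ∀ {n} → (Bigraph n → Subset n → Set) → Bigraph n → Set
Contains T H = ∃ (λ X → T H X)

-- By Hall's theorem H has an obstruction X. Minimum degree 3 gives 3 ≤ |N(X)|,
-- and the nonempty set B ∖ N(X) has at least 3 neighbours, all in A ∖ X, so
-- |X| ≤ 5: (|X|, |N(X)|) is (5,3), (4,3) or (5,4). In the first and last case
-- B ∖ N(X) is an obstruction of swap(H) of sizes (5,3) and (4,3) respectively.
-- A (4,3)-set is of type 4 unless it lies in an obstruction of type 1, 2 or 3.
-- For type 2 the set X ∪ {x₁} has sizes (5,4), so it dualises to a (4,3)-set of
-- swap(H), and the same analysis there yields type 3 or 4 in swap(H), type 1 in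
-- both graphs, or type 2 in both graphs.
module Submission where

open import Defs
open import Data.Bool using (Bool; true; false; _∧_; _∨_) renaming (_≟_ to _≟ᵇ_)
open import Data.Bool.Properties using (∨-zeroʳ)
open import Data.Empty using (⊥-elim)
open import Data.Fin using (Fin; zero; suc)
open import Data.Fin.Properties using (any?) renaming (_≟_ to _≟ᶠ_)
open import Data.Fin.Subset
open import Data.Fin.Subset.Properties
open import Data.Nat using (ℕ; zero; suc; _+_; _∸_; _≤_; _<_; z≤n; s≤s; _≤?_; _<?_)
  renaming (_≟_ to _≟ⁿ_)
open import Data.Nat.Properties
open import Data.Product using (Σ; ∃; _×_; _,_; proj₁; proj₂)
open import Data.Sum using (_⊎_; inj₁; inj₂)
open import Data.Vec using ([]; _∷_; tabulate; lookup; foldr; here; there)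
open import Data.Vec.Properties using (lookup∘tabulate; []=⇒lookup; lookup⇒[]=)
open import Relation.Nullary using (¬_; Dec; yes; no; ¬?)
open import Relation.Nullary.Decidable using (_×-dec_; _⊎-dec_)
open import Relation.Binary.PropositionalEquality
  using (_≡_; ≢-sym; refl; sym; trans; cong; cong₂; subst; subst₂; module ≡-Reasoning)

private variable
  n t : ℕ

∣p∪q∣+∣p∩q∣≡∣p∣+∣q∣ : ∀ (p q : Subset n) → ∣ p ∪ q ∣ + ∣ p ∩ q ∣ ≡ ∣ p ∣ + ∣ q ∣
∣p∪q∣+∣p∩q∣≡∣p∣+∣q∣ [] [] = refl
∣p∪q∣+∣p∩q∣≡∣p∣+∣q∣ (true ∷ p) (true ∷ q) =
  cong suc (trans (+-suc _ _) (trans (cong suc (∣p∪q∣+∣p∩q∣≡∣p∣+∣q∣ p q)) (sym (+-suc _ _))))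
∣p∪q∣+∣p∩q∣≡∣p∣+∣q∣ (true ∷ p) (false ∷ q) = cong suc (∣p∪q∣+∣p∩q∣≡∣p∣+∣q∣ p q)
∣p∪q∣+∣p∩q∣≡∣p∣+∣q∣ (false ∷ p) (true ∷ q) =
  trans (cong suc (∣p∪q∣+∣p∩q∣≡∣p∣+∣q∣ p q)) (sym (+-suc _ _))
∣p∪q∣+∣p∩q∣≡∣p∣+∣q∣ (false ∷ p) (false ∷ q) = ∣p∪q∣+∣p∩q∣≡∣p∣+∣q∣ p q

∣p∪q∣≤∣p∣+∣q∣ : ∀ (p q : Subset n) → ∣ p ∪ q ∣ ≤ ∣ p ∣ + ∣ q ∣
∣p∪q∣≤∣p∣+∣q∣ p q = subst (∣ p ∪ q ∣ ≤_) (∣p∪q∣+∣p∩q∣≡∣p∣+∣q∣ p q) (m≤m+n _ _)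

disjoint⇒∣p∪q∣≡∣p∣+∣q∣ : ∀ (p q : Subset n) → Empty (p ∩ q) → ∣ p ∪ q ∣ ≡ ∣ p ∣ + ∣ q ∣
disjoint⇒∣p∪q∣≡∣p∣+∣q∣ {n} p q p∩q≡∅ = begin
  ∣ p ∪ q ∣               ≡⟨ sym (+-identityʳ _) ⟩
  ∣ p ∪ q ∣ + 0           ≡⟨ cong (∣ p ∪ q ∣ +_) (sym ∣p∩q∣≡0) ⟩
  ∣ p ∪ q ∣ + ∣ p ∩ q ∣   ≡⟨ ∣p∪q∣+∣p∩q∣≡∣p∣+∣q∣ p q ⟩
  ∣ p ∣ + ∣ q ∣           ∎
  where
  open ≡-Reasoning
  ∣p∩q∣≡0 : ∣ p ∩ q ∣ ≡ 0
  ∣p∩q∣≡0 = trans (cong ∣_∣ (Empty-unique p∩q≡∅)) (∣⊥∣≡0 n)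

x∈p⇒0<∣p∣ : ∀ {p : Subset n} {x} → x ∈ p → 0 < ∣ p ∣
x∈p⇒0<∣p∣ x∈p = ≤-<-trans z≤n (x∈p⇒∣p-x∣<∣p∣ x∈p)

0<∣p∣⇒Nonempty : ∀ (p : Subset n) → 0 < ∣ p ∣ → Nonempty p
0<∣p∣⇒Nonempty (true ∷ p) _ = zero , here
0<∣p∣⇒Nonempty (false ∷ p) 0<∣p∣ with 0<∣p∣⇒Nonempty p 0<∣p∣
... | x , x∈p = suc x , there x∈p

x∈p─q⇒x∉q : ∀ (p q : Subset n) {x} → x ∈ p ─ q → x ∉ q
x∈p─q⇒x∉q (_ ∷ p) (true ∷ q) {zero} () here
x∈p─q⇒x∉q (_ ∷ p) (false ∷ q) {zero} _ ()
x∈p─q⇒x∉q (_ ∷ p) (_ ∷ q) {suc x} (there x∈p─q) (there x∈q) = x∈p─q⇒x∉q p q x∈p─q x∈q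

any-true⁻ : ∀ {n} (g : Fin n → Bool) → foldr _ _∨_ false (tabulate g) ≡ true → ∃ λ a → g a ≡ true
any-true⁻ {zero} g ()
any-true⁻ {suc n} g any≡true with g zero in g0≡
... | true = zero , g0≡
... | false with any-true⁻ (λ a → g (suc a)) any≡true
...   | a , ga≡true = suc a , ga≡true

any-true⁺ : ∀ {n} (g : Fin n → Bool) a → g a ≡ true → foldr _ _∨_ false (tabulate g) ≡ true
any-true⁺ g zero ga≡true rewrite ga≡true = refl
any-true⁺ g (suc a) ga≡true =
  trans (cong (g zero ∨_) (any-true⁺ (λ x → g (suc x)) a ga≡true)) (∨-zeroʳ (g zero))

∈tabulate⁺ : ∀ (f : Fin n → Bool) {b} → f b ≡ true → b ∈ tabulate f
∈tabulate⁺ f {b} fb≡true = lookup⇒[]= b (tabulate f) (trans (lookup∘tabulate f b) fb≡true)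

∈tabulate⁻ : ∀ (f : Fin n → Bool) {b} → b ∈ tabulate f → f b ≡ true
∈tabulate⁻ f {b} b∈ = trans (sym (lookup∘tabulate f b)) ([]=⇒lookup b∈)

∈N⁻ : ∀ (G : Bigraph n) X {b} → b ∈ N G X → ∃ λ a → a ∈ X × G a b ≡ true
∈N⁻ G X {b} b∈ with any-true⁻ _ (∈tabulate⁻ _ b∈)
... | a , _ with lookup X a in X[a]≡true | G a b in Gab≡true
...   | true | true = a , lookup⇒[]= a X X[a]≡true , Gab≡true

∈N⁺ : ∀ (G : Bigraph n) {X a b} → a ∈ X → G a b ≡ true → b ∈ N G X
∈N⁺ G {X} {a} a∈X Gab≡true = ∈tabulate⁺ _ (any-true⁺ _ a
  (subst (λ s → s ∧ G a _ ≡ true) (sym ([]=⇒lookup a∈X)) Gab≡true))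

N-mono : ∀ (G : Bigraph n) {X Y} → X ⊆ Y → N G X ⊆ N G Y
N-mono G {X} X⊆Y b∈ with ∈N⁻ G X b∈
... | a , a∈X , Gab = ∈N⁺ G (X⊆Y a∈X) Gab

N-∪ : ∀ (G : Bigraph n) X Y → N G (X ∪ Y) ⊆ N G X ∪ N G Y
N-∪ G X Y b∈ with ∈N⁻ G (X ∪ Y) b∈
... | a , a∈X∪Y , Gab with x∈p∪q⁻ X Y a∈X∪Y
...   | inj₁ a∈X = x∈p∪q⁺ (inj₁ (∈N⁺ G a∈X Gab))
...   | inj₂ a∈Y = x∈p∪q⁺ (inj₂ (∈N⁺ G a∈Y Gab))

degA≤∣N∣ : ∀ (G : Bigraph n) {X a} → a ∈ X → degA G a ≤ ∣ N G X ∣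
degA≤∣N∣ G a∈X = p⊆q⇒∣p∣≤∣q∣ (λ b∈ → ∈N⁺ G a∈X (∈tabulate⁻ _ b∈))

-- Matchings and Hall's condition relative to SA ⊆ A and SB ⊆ B, so that Hall's
-- theorem can be proved by induction on |SA|.

Matching : Bigraph n → Subset n → Subset n → Set
Matching {n} G SA SB = Σ (Fin n → Fin n) λ f →
  (∀ {a} → a ∈ SA → f a ∈ SB × G a (f a) ≡ true) ×
  (∀ {a a′} → a ∈ SA → a′ ∈ SA → f a ≡ f a′ → a ≡ a′)

HallCondition : Bigraph n → Subset n → Subset n → Set
HallCondition G SA SB = ∀ X → X ⊆ SA → ∣ X ∣ ≤ ∣ N G X ∩ SB ∣

Critical : Bigraph n → Subset n → Subset n → Subset n → Set
Critical G SA SB X = X ⊆ SA × 0 < ∣ X ∣ × ∣ X ∣ < ∣ SA ∣ × ∣ N G X ∩ SB ∣ ≤ ∣ X ∣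

critical? : ∀ (G : Bigraph n) SA SB X → Dec (Critical G SA SB X)
critical? G SA SB X =
  (X ⊆? SA) ×-dec (0 <? ∣ X ∣) ×-dec (∣ X ∣ <? ∣ SA ∣) ×-dec (∣ N G X ∩ SB ∣ ≤? ∣ X ∣)

emptyMatching : ∀ {G : Bigraph n} {SA SB} → Empty SA → Matching G SA SB
emptyMatching SA≡∅ =
  (λ a → a) , (λ a∈ → ⊥-elim (SA≡∅ (_ , a∈))) , (λ a∈ _ _ → ⊥-elim (SA≡∅ (_ , a∈)))

singletonMatching : ∀ {G : Bigraph n} {SB a b} → b ∈ SB → G a b ≡ true →
  Matching G ⁅ a ⁆ (⁅ b ⁆ ∩ SB)
singletonMatching {G = G} {SB} {a} {b} b∈SB Gab≡true = (λ _ → b) , edge , injective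
  where
  edge : ∀ {x} → x ∈ ⁅ a ⁆ → b ∈ ⁅ b ⁆ ∩ SB × G x b ≡ true
  edge x∈ = x∈p∩q⁺ (x∈⁅x⁆ b , b∈SB) , subst (λ x → G x b ≡ true) (sym (x∈⁅y⁆⇒x≡y a x∈)) Gab≡true
  injective : ∀ {x x′} → x ∈ ⁅ a ⁆ → x′ ∈ ⁅ a ⁆ → b ≡ b → x ≡ x′
  injective x∈ x′∈ _ = trans (x∈⁅y⁆⇒x≡y a x∈) (sym (x∈⁅y⁆⇒x≡y a x′∈))

glueMatchings : ∀ {G : Bigraph n} {SA SB} X T →
  Matching G X (T ∩ SB) → Matching G (SA ─ X) (SB ─ T) → Matching G SA SB
glueMatchings {G = G} {SA} {SB} X T (f₁ , edge₁ , inj₁′) (f₂ , edge₂ , inj₂′) = f , edge , injective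
  where
  f : Fin _ → Fin _
  f a with a ∈? X
  ... | yes _ = f₁ a
  ... | no _ = f₂ a
  f₁∈T : ∀ {a} → a ∈ X → f₁ a ∈ T
  f₁∈T a∈X = proj₁ (x∈p∩q⁻ T SB (proj₁ (edge₁ a∈X)))
  f₂∉T : ∀ {a} → a ∈ SA → a ∉ X → f₂ a ∉ T
  f₂∉T a∈SA a∉X = x∈p─q⇒x∉q SB T (proj₁ (edge₂ (x∈p∧x∉q⇒x∈p─q a∈SA a∉X)))
  edge : ∀ {a} → a ∈ SA → f a ∈ SB × G a (f a) ≡ true
  edge {a} a∈SA with a ∈? X
  ... | yes a∈X = let (fa∈ , Gafa) = edge₁ a∈X in proj₂ (x∈p∩q⁻ T SB fa∈) , Gafa
  ... | no a∉X = let (fa∈ , Gafa) = edge₂ (x∈p∧x∉q⇒x∈p─q a∈SA a∉X) in p─q⊆p SB T fa∈ , Gafa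
  injective : ∀ {a a′} → a ∈ SA → a′ ∈ SA → f a ≡ f a′ → a ≡ a′
  injective {a} {a′} a∈SA a′∈SA fa≡fa′ with a ∈? X | a′ ∈? X
  ... | yes a∈X | yes a′∈X = inj₁′ a∈X a′∈X fa≡fa′
  ... | no a∉X | no a′∉X =
    inj₂′ (x∈p∧x∉q⇒x∈p─q a∈SA a∉X) (x∈p∧x∉q⇒x∈p─q a′∈SA a′∉X) fa≡fa′
  ... | yes a∈X | no a′∉X = ⊥-elim (f₂∉T a′∈SA a′∉X (subst (_∈ T) fa≡fa′ (f₁∈T a∈X)))
  ... | no a∉X | yes a′∈X = ⊥-elim (f₂∉T a∈SA a∉X (subst (_∈ T) (sym fa≡fa′) (f₁∈T a′∈X)))

HallCondition⇒neighbour : ∀ {G : Bigraph n} {SA SB a} → HallCondition G SA SB → a ∈ SA →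
  ∃ λ b → b ∈ SB × G a b ≡ true
HallCondition⇒neighbour {G = G} {SA} {SB} {a} hall a∈SA
  with 0<∣p∣⇒Nonempty (N G ⁅ a ⁆ ∩ SB)
         (subst (_≤ ∣ N G ⁅ a ⁆ ∩ SB ∣) (∣⁅x⁆∣≡1 a) (hall ⁅ a ⁆ ⁅a⁆⊆SA))
  where
  ⁅a⁆⊆SA : ⁅ a ⁆ ⊆ SA
  ⁅a⁆⊆SA x∈ = subst (_∈ SA) (sym (x∈⁅y⁆⇒x≡y a x∈)) a∈SA
... | b , b∈ with x∈p∩q⁻ (N G ⁅ a ⁆) SB b∈
...   | b∈N , b∈SB with ∈N⁻ G ⁅ a ⁆ b∈N
...     | x , x∈ , Gxb = b , b∈SB , subst (λ x → G x b ≡ true) (x∈⁅y⁆⇒x≡y a x∈) Gxb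

HallCondition-inside : ∀ {G : Bigraph n} {SA SB X} → HallCondition G SA SB → X ⊆ SA →
  HallCondition G X (N G X ∩ SB)
HallCondition-inside {G = G} {SB = SB} hall X⊆SA Y Y⊆X = ≤-trans (hall Y (⊆-trans Y⊆X X⊆SA))
  (p⊆q⇒∣p∣≤∣q∣ λ b∈ → let (b∈NY , b∈SB) = x∈p∩q⁻ (N G Y) SB b∈ in
    x∈p∩q⁺ (b∈NY , x∈p∩q⁺ (N-mono G Y⊆X b∈NY , b∈SB)))

-- Adding a critical set X to Y ⊆ SA ∖ X costs at most |X| new neighbours.
HallCondition-outside : ∀ {G : Bigraph n} {SA SB X} → HallCondition G SA SB → X ⊆ SA →
  ∣ N G X ∩ SB ∣ ≤ ∣ X ∣ → HallCondition G (SA ─ X) (SB ─ N G X)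
HallCondition-outside {G = G} {SA} {SB} {X} hall X⊆SA X-tight Y Y⊆SA─X =
  +-cancelʳ-≤ (∣ X ∣) (∣ Y ∣) (∣ N G Y ∩ (SB ─ N G X) ∣) (begin
    ∣ Y ∣ + ∣ X ∣                              ≡⟨ disjoint⇒∣p∪q∣≡∣p∣+∣q∣ Y X Y∩X≡∅ ⟨
    ∣ Y ∪ X ∣                                  ≤⟨ hall (Y ∪ X) Y∪X⊆SA ⟩
    ∣ N G (Y ∪ X) ∩ SB ∣                       ≤⟨ p⊆q⇒∣p∣≤∣q∣ split ⟩
    ∣ (N G Y ∩ (SB ─ N G X)) ∪ (N G X ∩ SB) ∣  ≤⟨ ∣p∪q∣≤∣p∣+∣q∣ (N G Y ∩ (SB ─ N G X)) _ ⟩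
    ∣ N G Y ∩ (SB ─ N G X) ∣ + ∣ N G X ∩ SB ∣  ≤⟨ +-monoʳ-≤ _ X-tight ⟩
    ∣ N G Y ∩ (SB ─ N G X) ∣ + ∣ X ∣           ∎)
  where
  open ≤-Reasoning
  Y∩X≡∅ : Empty (Y ∩ X)
  Y∩X≡∅ (a , a∈) = let (a∈Y , a∈X) = x∈p∩q⁻ Y X a∈ in x∈p─q⇒x∉q SA X (Y⊆SA─X a∈Y) a∈X
  Y∪X⊆SA : Y ∪ X ⊆ SA
  Y∪X⊆SA a∈ with x∈p∪q⁻ Y X a∈
  ... | inj₁ a∈Y = p─q⊆p SA X (Y⊆SA─X a∈Y)
  ... | inj₂ a∈X = X⊆SA a∈X
  split : N G (Y ∪ X) ∩ SB ⊆ (N G Y ∩ (SB ─ N G X)) ∪ (N G X ∩ SB)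
  split {b} b∈ with x∈p∩q⁻ (N G (Y ∪ X)) SB b∈ | b ∈? N G X
  ... | _ , b∈SB | yes b∈NX = x∈p∪q⁺ (inj₂ (x∈p∩q⁺ (b∈NX , b∈SB)))
  ... | b∈N , b∈SB | no b∉NX with x∈p∪q⁻ (N G Y) (N G X) (N-∪ G Y X b∈N)
  ...   | inj₁ b∈NY = x∈p∪q⁺ (inj₁ (x∈p∩q⁺ (b∈NY , x∈p∧x∉q⇒x∈p─q b∈SB b∉NX)))
  ...   | inj₂ b∈NX = ⊥-elim (b∉NX b∈NX)

-- Without critical sets every nonempty Y ⊆ SA − a has a spare neighbour, so
-- removing any b from SB keeps Hall's condition.
HallCondition-surplus : ∀ {G : Bigraph n} {SA SB a} → (∀ Y → ¬ Critical G SA SB Y) → a ∈ SA →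
  ∀ b → HallCondition G (SA - a) (SB - b)
HallCondition-surplus {G = G} {SA} {SB} {a} noCritical a∈SA b Y Y⊆SA-a with 0 <? ∣ Y ∣
... | no ∣Y∣≯0 = ≤-trans (≮⇒≥ ∣Y∣≯0) z≤n
... | yes 0<∣Y∣ = ≤-pred (begin
    suc ∣ Y ∣                                 ≤⟨ ∣Y∣<∣NY∩SB∣ ⟩
    ∣ N G Y ∩ SB ∣                            ≤⟨ p⊆q⇒∣p∣≤∣q∣ split ⟩
    ∣ (N G Y ∩ (SB - b)) ∪ ⁅ b ⁆ ∣            ≤⟨ ∣p∪q∣≤∣p∣+∣q∣ (N G Y ∩ (SB - b)) ⁅ b ⁆ ⟩
    ∣ N G Y ∩ (SB - b) ∣ + ∣ ⁅ b ⁆ ∣          ≡⟨ cong (∣ N G Y ∩ (SB - b) ∣ +_) (∣⁅x⁆∣≡1 b) ⟩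
    ∣ N G Y ∩ (SB - b) ∣ + 1                  ≡⟨ +-comm _ 1 ⟩
    suc ∣ N G Y ∩ (SB - b) ∣                  ∎)
  where
  open ≤-Reasoning
  Y⊆SA : Y ⊆ SA
  Y⊆SA a∈ = p─q⊆p SA _ (Y⊆SA-a a∈)
  ∣Y∣<∣NY∩SB∣ : ∣ Y ∣ < ∣ N G Y ∩ SB ∣
  ∣Y∣<∣NY∩SB∣ = ≰⇒> λ tight →
    noCritical Y (Y⊆SA , 0<∣Y∣ , ≤-<-trans (p⊆q⇒∣p∣≤∣q∣ Y⊆SA-a) (x∈p⇒∣p-x∣<∣p∣ a∈SA) , tight)
  split : N G Y ∩ SB ⊆ (N G Y ∩ (SB - b)) ∪ ⁅ b ⁆
  split {b′} b′∈ with x∈p∩q⁻ (N G Y) SB b′∈ | b′ ≟ᶠ b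
  ... | _ | yes refl = x∈p∪q⁺ (inj₂ (x∈⁅x⁆ b))
  ... | b′∈NY , b′∈SB | no b′≢b = x∈p∪q⁺ (inj₁ (x∈p∩q⁺ (b′∈NY , x∈p∧x≢y⇒x∈p-y b′∈SB b′≢b)))

-- If some nonempty proper X ⊆ SA is critical, match X into N(X) and SA ∖ X into
-- SB ∖ N(X); otherwise match any a ∈ SA to a neighbour b and remove both.
hallMatching : ∀ (G : Bigraph n) k SA SB → ∣ SA ∣ ≤ k → HallCondition G SA SB → Matching G SA SB
hallMatching G zero SA SB ∣SA∣≤0 _ = emptyMatching {G = G} λ (a , a∈) → <⇒≱ (x∈p⇒0<∣p∣ a∈) ∣SA∣≤0
hallMatching G (suc k) SA SB ∣SA∣≤1+k hall-SA with nonempty? SA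
... | no SA≡∅ = emptyMatching {G = G} SA≡∅
... | yes (a , a∈SA) with anySubset? (critical? G SA SB)
...   | yes (X , X⊆SA , 0<∣X∣ , ∣X∣<∣SA∣ , X-tight) =
  glueMatchings {G = G} X (N G X)
    (hallMatching G k X (N G X ∩ SB) (≤-pred (≤-trans ∣X∣<∣SA∣ ∣SA∣≤1+k))
      (HallCondition-inside hall-SA X⊆SA))
    (hallMatching G k (SA ─ X) (SB ─ N G X)
      (≤-pred (≤-trans (p∩q≢∅⇒∣p─q∣<∣p∣ SA X SA∩X≢∅) ∣SA∣≤1+k))
      (HallCondition-outside hall-SA X⊆SA X-tight))
  where
  SA∩X≢∅ : Nonempty (SA ∩ X)
  SA∩X≢∅ = let (x , x∈X) = 0<∣p∣⇒Nonempty X 0<∣X∣ in x , x∈p∩q⁺ (X⊆SA x∈X , x∈X)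
...   | no noCritical with HallCondition⇒neighbour hall-SA a∈SA
...     | b , b∈SB , Gab =
  glueMatchings {G = G} ⁅ a ⁆ ⁅ b ⁆ (singletonMatching b∈SB Gab)
    (hallMatching G k (SA - a) (SB - b) (≤-pred (≤-trans (x∈p⇒∣p-x∣<∣p∣ a∈SA) ∣SA∣≤1+k))
      (HallCondition-surplus (λ Y critical → noCritical (Y , critical)) a∈SA b))

hallTheorem : ∀ (G : Bigraph n) → (∀ X → ∣ X ∣ ≤ ∣ N G X ∣) → HasOneFactor G
hallTheorem {n} G hall with hallMatching G n ⊤ ⊤ (∣p∣≤n ⊤) hall-⊤
  where
  hall-⊤ : HallCondition G ⊤ ⊤
  hall-⊤ X _ = ≤-trans (hall X) (p⊆q⇒∣p∣≤∣q∣ {p = N G X} {q = N G X ∩ ⊤} λ b∈ → x∈p∩q⁺ (b∈ , ∈⊤))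
... | f , edge , injective = f , injective ∈⊤ ∈⊤ , λ a → proj₂ (edge ∈⊤)

¬HasOneFactor⇒obstruction : ∀ (G : Bigraph n) → ¬ HasOneFactor G → ∃ (IsObstruction G)
¬HasOneFactor⇒obstruction G ¬1F with anySubset? (λ X → ∣ N G X ∣ <? ∣ X ∣)
... | yes obstruction = obstruction
... | no noObstruction = ⊥-elim (¬1F (hallTheorem G λ X →
  ≮⇒≥ λ ∣NX∣<∣X∣ → noObstruction (X , ∣NX∣<∣X∣)))

swap-IsSTBigraph : ∀ (G : Bigraph n) → IsSTBigraph n t G → IsSTBigraph n t (swap G)
swap-IsSTBigraph G (degA≥t , degB≥t) = degB≥t , degA≥t

IsSTBigraph⇒t≤∣N∣ : ∀ (G : Bigraph n) → IsSTBigraph n t G → ∀ {X a} → a ∈ X → t ≤ ∣ N G X ∣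
IsSTBigraph⇒t≤∣N∣ G (degA≥t , _) a∈X = ≤-trans (degA≥t _) (degA≤∣N∣ G a∈X)

N-swap-∁N⊆∁ : ∀ (G : Bigraph n) X → N (swap G) (∁ (N G X)) ⊆ ∁ X
N-swap-∁N⊆∁ G X a∈ with ∈N⁻ (swap G) (∁ (N G X)) a∈
... | b , b∈∁NX , Gab = x∉p⇒x∈∁p λ a∈X → x∈∁p⇒x∉p b∈∁NX (∈N⁺ G a∈X Gab)

∣N-swap-∁N∣-bounds : ∀ (G : Bigraph n) → IsSTBigraph n t G → ∀ X → ∣ N G X ∣ < n →
  t ≤ ∣ N (swap G) (∁ (N G X)) ∣ × ∣ N (swap G) (∁ (N G X)) ∣ ≤ n ∸ ∣ X ∣
∣N-swap-∁N∣-bounds G st X ∣NX∣<n =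
  IsSTBigraph⇒t≤∣N∣ (swap G) (swap-IsSTBigraph G st) (proj₂ ∁NX≢∅) ,
  ≤-trans (p⊆q⇒∣p∣≤∣q∣ (N-swap-∁N⊆∁ G X)) (≤-reflexive (∣∁p∣≡n∸∣p∣ X))
  where
  ∁NX≢∅ : Nonempty (∁ (N G X))
  ∁NX≢∅ = 0<∣p∣⇒Nonempty (∁ (N G X))
    (subst (0 <_) (sym (∣∁p∣≡n∸∣p∣ (N G X))) (m<n⇒0<n∸m ∣NX∣<n))

IsObstruction⇒t≤∣N∣ : ∀ (G : Bigraph n) → IsSTBigraph n t G → ∀ X → IsObstruction G X →
  t ≤ ∣ N G X ∣
IsObstruction⇒t≤∣N∣ G st X ∣NX∣<∣X∣ =
  IsSTBigraph⇒t≤∣N∣ G st (proj₂ (0<∣p∣⇒Nonempty X (≤-<-trans z≤n ∣NX∣<∣X∣)))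

IsObstruction⇒∣X∣≤n∸t : ∀ (G : Bigraph n) → IsSTBigraph n t G → ∀ X → IsObstruction G X →
  ∣ X ∣ ≤ n ∸ t
IsObstruction⇒∣X∣≤n∸t {n} {t} G st X ∣NX∣<∣X∣
  with ∣N-swap-∁N∣-bounds G st X (<-≤-trans ∣NX∣<∣X∣ (∣p∣≤n X))
... | t≤dual , dual≤n∸∣X∣ = m+n≤o⇒m≤o∸n ∣ X ∣ (subst (_≤ n) (+-comm t ∣ X ∣)
  (m≤o∸n⇒m+n≤o t (∣p∣≤n X) (≤-trans t≤dual dual≤n∸∣X∣)))

∣N-swap-∁N∣≡t : ∀ (G : Bigraph n) → IsSTBigraph n t G → ∀ X → ∣ X ∣ + t ≡ n → ∣ N G X ∣ < n →
  ∣ N (swap G) (∁ (N G X)) ∣ ≡ t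
∣N-swap-∁N∣≡t {n} {t} G st X ∣X∣+t≡n ∣NX∣<n with ∣N-swap-∁N∣-bounds G st X ∣NX∣<n
... | t≤dual , dual≤n∸∣X∣ = ≤-antisym (subst (_ ≤_) n∸∣X∣≡t dual≤n∸∣X∣) t≤dual
  where
  n∸∣X∣≡t : n ∸ ∣ X ∣ ≡ t
  n∸∣X∣≡t = trans (cong (_∸ ∣ X ∣) (sym ∣X∣+t≡n)) (m+n∸m≡n ∣ X ∣ t)

sizes⇒IsObstruction : ∀ (G : Bigraph n) X {k m} → ∣ X ∣ ≡ k → ∣ N G X ∣ ≡ m → m < k →
  IsObstruction G X
sizes⇒IsObstruction G X ∣X∣≡k ∣NX∣≡m m<k = subst₂ _<_ (sym ∣NX∣≡m) (sym ∣X∣≡k) m<k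

ObstructionSizes : ℕ → ℕ → Set
ObstructionSizes k m = (k ≡ 5 × m ≡ 3) ⊎ (k ≡ 4 × m ≡ 3) ⊎ (k ≡ 5 × m ≡ 4)

obstructionSizes : ∀ {k m} → 3 ≤ m → m < k → k ≤ 5 → ObstructionSizes k m
obstructionSizes {k} {m} 3≤m m<k k≤5 with m ≟ⁿ 3 | k ≟ⁿ 5
... | yes refl | yes refl = inj₁ (refl , refl)
... | yes refl | no k≢5 = inj₂ (inj₁ (≤-antisym (≤-pred (≤∧≢⇒< k≤5 k≢5)) m<k , refl))
... | no m≢3 | _ = inj₂ (inj₂ (k≡5 , ≤-antisym (≤-pred (subst (m <_) k≡5 m<k)) 3<m))
  where
  3<m : 3 < m
  3<m = ≤∧≢⇒< 3≤m (≢-sym m≢3)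
  k≡5 : k ≡ 5
  k≡5 = ≤-antisym k≤5 (<-≤-trans (s≤s 3<m) m<k)

IsObstruction⇒sizes : ∀ (G : Bigraph 8) → IsSTBigraph 8 3 G → ∀ X → IsObstruction G X →
  ObstructionSizes ∣ X ∣ ∣ N G X ∣
IsObstruction⇒sizes G st X X-obs =
  obstructionSizes (IsObstruction⇒t≤∣N∣ G st X X-obs) X-obs (IsObstruction⇒∣X∣≤n∸t G st X X-obs)

∁N-dual : ∀ (G : Bigraph 8) → IsSTBigraph 8 3 G → ∀ X {m} → ∣ X ∣ ≡ 5 → ∣ N G X ∣ ≡ m → m < 5 →
  ∣ ∁ (N G X) ∣ ≡ 8 ∸ m × ∣ N (swap G) (∁ (N G X)) ∣ ≡ 3
∁N-dual G st X ∣X∣≡5 ∣NX∣≡m m<5 =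
  trans (∣∁p∣≡n∸∣p∣ (N G X)) (cong (8 ∸_) ∣NX∣≡m) ,
  ∣N-swap-∁N∣≡t {t = 3} G st X (cong (_+ 3) ∣X∣≡5)
    (subst (_< 8) (sym ∣NX∣≡m) (≤-trans m<5 (m≤m+n 5 3)))

Type1-dual : ∀ (G : Bigraph 8) → IsSTBigraph 8 3 G → ∀ X → Type1 G X → Type1 (swap G) (∁ (N G X))
Type1-dual G st X (_ , ∣X∣≡5 , ∣NX∣≡3) =
  sizes⇒IsObstruction (swap G) (∁ (N G X)) ∣∁NX∣≡5 ∣dual∣≡3 (n≤1+n 4) , ∣∁NX∣≡5 , ∣dual∣≡3
  where
  ∣∁NX∣≡5 : ∣ ∁ (N G X) ∣ ≡ 5
  ∣∁NX∣≡5 = proj₁ (∁N-dual G st X ∣X∣≡5 ∣NX∣≡3 (n≤1+n 4))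
  ∣dual∣≡3 : ∣ N (swap G) (∁ (N G X)) ∣ ≡ 3
  ∣dual∣≡3 = proj₂ (∁N-dual G st X ∣X∣≡5 ∣NX∣≡3 (n≤1+n 4))

FourThreeSet : Bigraph n → Set
FourThreeSet {n} G = Σ (Subset n) λ Z → ∣ Z ∣ ≡ 4 × ∣ N G Z ∣ ≡ 3

fiveFour-dual : ∀ (G : Bigraph 8) → IsSTBigraph 8 3 G → ∀ X → ∣ X ∣ ≡ 5 → ∣ N G X ∣ ≡ 4 →
  FourThreeSet (swap G)
fiveFour-dual G st X ∣X∣≡5 ∣NX∣≡4 = ∁ (N G X) , ∁N-dual G st X ∣X∣≡5 ∣NX∣≡4 ≤-refl

Type2⇒FourThreeSet-swap : ∀ (G : Bigraph 8) → IsSTBigraph 8 3 G → ∀ X → Type2 G X →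
  FourThreeSet (swap G)
Type2⇒FourThreeSet-swap G st X (_ , ∣X∣≡4 , _ , x₁ , x₁∉X , _ , _ , ∣NX+x₁∣≡4 , _) =
  fiveFour-dual G st (X ∪ ⁅ x₁ ⁆) ∣X+x₁∣≡5 ∣NX+x₁∣≡4
  where
  X∩⁅x₁⁆≡∅ : Empty (X ∩ ⁅ x₁ ⁆)
  X∩⁅x₁⁆≡∅ (x , x∈) = let (x∈X , x∈⁅x₁⁆) = x∈p∩q⁻ X ⁅ x₁ ⁆ x∈ in
    x₁∉X (subst (_∈ X) (x∈⁅y⁆⇒x≡y x₁ x∈⁅x₁⁆) x∈X)
  ∣X+x₁∣≡5 : ∣ X ∪ ⁅ x₁ ⁆ ∣ ≡ 5
  ∣X+x₁∣≡5 = trans (disjoint⇒∣p∪q∣≡∣p∣+∣q∣ X ⁅ x₁ ⁆ X∩⁅x₁⁆≡∅) (cong₂ _+_ ∣X∣≡4 (∣⁅x⁆∣≡1 x₁))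

type1? : ∀ (G : Bigraph n) X → Dec (Type1 G X)
type1? G X = (∣ N G X ∣ <? ∣ X ∣) ×-dec (∣ X ∣ ≟ⁿ 5) ×-dec (∣ N G X ∣ ≟ⁿ 3)

type2? : ∀ (G : Bigraph n) X → Dec (Type2 G X)
type2? G X = (∣ N G X ∣ <? ∣ X ∣) ×-dec (∣ X ∣ ≟ⁿ 4) ×-dec (∣ N G X ∣ ≟ⁿ 3) ×-dec
  any? (λ x₁ → ¬? (x₁ ∈? X) ×-dec any? (λ b₁ → (G x₁ b₁ ≟ᵇ true) ×-dec
    (∣ N G (X ∪ ⁅ x₁ ⁆) ∣ ≟ⁿ 4) ×-dec (∣ N (removeEdge G x₁ b₁) (X ∪ ⁅ x₁ ⁆) ∣ ≟ⁿ 3)))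

type3? : ∀ (G : Bigraph n) X → Dec (Type3 G X)
type3? G X = (∣ N G X ∣ <? ∣ X ∣) ×-dec (∣ X ∣ ≟ⁿ 4) ×-dec (∣ N G X ∣ ≟ⁿ 3) ×-dec
  any? (λ x₁ → ¬? (x₁ ∈? X) ×-dec any? (λ b₁ → any? (λ b₂ → ¬? (b₁ ≟ᶠ b₂) ×-dec
    (G x₁ b₁ ≟ᵇ true) ×-dec (G x₁ b₂ ≟ᵇ true) ×-dec
    (∣ N G (X ∪ ⁅ x₁ ⁆) ∣ ≟ⁿ 5) ×-dec
    (∣ N (removeEdge (removeEdge G x₁ b₁) x₁ b₂) (X ∪ ⁅ x₁ ⁆) ∣ ≟ⁿ 3))))

FourThreeSet-classify : ∀ (G : Bigraph n) → FourThreeSet G →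
  Contains Type1 G ⊎ Contains Type2 G ⊎ Contains Type3 G ⊎ Contains Type4 G
FourThreeSet-classify G (X , ∣X∣≡4 , ∣NX∣≡3)
  with anySubset? (λ Y → (X ⊆? Y) ×-dec (type1? G Y ⊎-dec type2? G Y ⊎-dec type3? G Y))
... | yes (Y , _ , inj₁ t₁) = inj₁ (Y , t₁)
... | yes (Y , _ , inj₂ (inj₁ t₂)) = inj₂ (inj₁ (Y , t₂))
... | yes (Y , _ , inj₂ (inj₂ t₃)) = inj₂ (inj₂ (inj₁ (Y , t₃)))
... | no noSuperset = inj₂ (inj₂ (inj₂ (X , sizes⇒IsObstruction G X ∣X∣≡4 ∣NX∣≡3 ≤-refl ,
        ∣X∣≡4 , ∣NX∣≡3 , λ Y X⊆Y t → noSuperset (Y , X⊆Y , t))))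

FourThreeOutcome : Bigraph n → Set
FourThreeOutcome G = Contains Type3 G ⊎ Contains Type4 G ⊎
  (Contains Type1 G × Contains Type1 (swap G)) ⊎ (Contains Type2 G × FourThreeSet (swap G))

FourThreeSet⇒outcome : ∀ (G : Bigraph 8) → IsSTBigraph 8 3 G → FourThreeSet G → FourThreeOutcome G
FourThreeSet⇒outcome G st Z = outcome (FourThreeSet-classify G Z)
  where
  outcome : Contains Type1 G ⊎ Contains Type2 G ⊎ Contains Type3 G ⊎ Contains Type4 G →
    FourThreeOutcome G
  outcome (inj₁ (Y , t₁)) = inj₂ (inj₂ (inj₁ ((Y , t₁) , (∁ (N G Y) , Type1-dual G st Y t₁))))
  outcome (inj₂ (inj₁ (Y , t₂))) = inj₂ (inj₂ (inj₂ ((Y , t₂) , Type2⇒FourThreeSet-swap G st Y t₂)))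
  outcome (inj₂ (inj₂ (inj₁ t₃))) = inj₁ t₃
  outcome (inj₂ (inj₂ (inj₂ t₄))) = inj₂ (inj₁ t₄)

Conclusion : Bigraph n → Set
Conclusion H = ((Contains Type1 H × Contains Type1 (swap H))
      ⊎ (Contains Type2 H × Contains Type2 (swap H)))
    ⊎ (Contains Type3 H ⊎ Contains Type4 H ⊎ Contains Type3 (swap H) ⊎ Contains Type4 (swap H))

Conclusion-swap : ∀ {H : Bigraph n} → Conclusion (swap H) → Conclusion H
Conclusion-swap (inj₁ (inj₁ (t₁ , t₁′))) = inj₁ (inj₁ (t₁′ , t₁))
Conclusion-swap (inj₁ (inj₂ (t₂ , t₂′))) = inj₁ (inj₂ (t₂′ , t₂))
Conclusion-swap (inj₂ (inj₁ t₃′)) = inj₂ (inj₂ (inj₂ (inj₁ t₃′)))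
Conclusion-swap (inj₂ (inj₂ (inj₁ t₄′))) = inj₂ (inj₂ (inj₂ (inj₂ t₄′)))
Conclusion-swap (inj₂ (inj₂ (inj₂ (inj₁ t₃)))) = inj₂ (inj₁ t₃)
Conclusion-swap (inj₂ (inj₂ (inj₂ (inj₂ t₄)))) = inj₂ (inj₂ (inj₁ t₄))

FourThreeOutcome⇒Conclusion : ∀ {H : Bigraph n} →
  (FourThreeSet (swap H) → FourThreeOutcome (swap H)) → FourThreeOutcome H → Conclusion H
FourThreeOutcome⇒Conclusion _ (inj₁ t₃) = inj₂ (inj₁ t₃)
FourThreeOutcome⇒Conclusion _ (inj₂ (inj₁ t₄)) = inj₂ (inj₂ (inj₁ t₄))
FourThreeOutcome⇒Conclusion _ (inj₂ (inj₂ (inj₁ t₁s))) = inj₁ (inj₁ t₁s)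
FourThreeOutcome⇒Conclusion outcome′ (inj₂ (inj₂ (inj₂ (t₂ , Z′)))) with outcome′ Z′
... | inj₁ t₃′ = inj₂ (inj₂ (inj₂ (inj₁ t₃′)))
... | inj₂ (inj₁ t₄′) = inj₂ (inj₂ (inj₂ (inj₂ t₄′)))
... | inj₂ (inj₂ (inj₁ (t₁′ , t₁))) = inj₁ (inj₁ (t₁ , t₁′))
... | inj₂ (inj₂ (inj₂ (t₂′ , _))) = inj₁ (inj₂ (t₂ , t₂′))

FourThreeSet⇒Conclusion : ∀ (H : Bigraph 8) → IsSTBigraph 8 3 H → FourThreeSet H → Conclusion H
FourThreeSet⇒Conclusion H st Z = FourThreeOutcome⇒Conclusion
  (FourThreeSet⇒outcome (swap H) (swap-IsSTBigraph H st)) (FourThreeSet⇒outcome H st Z)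

IsObstruction⇒Conclusion : ∀ (H : Bigraph 8) → IsSTBigraph 8 3 H → ∀ X → IsObstruction H X →
  Conclusion H
IsObstruction⇒Conclusion H st X X-obs = bySizes (IsObstruction⇒sizes H st X X-obs)
  where
  bySizes : ObstructionSizes ∣ X ∣ ∣ N H X ∣ → Conclusion H
  bySizes (inj₁ (∣X∣≡5 , ∣NX∣≡3)) =
    inj₁ (inj₁ ((X , t₁) , (∁ (N H X) , Type1-dual H st X t₁)))
    where
    t₁ : Type1 H X
    t₁ = X-obs , ∣X∣≡5 , ∣NX∣≡3
  bySizes (inj₂ (inj₁ (∣X∣≡4 , ∣NX∣≡3))) = FourThreeSet⇒Conclusion H st (X , ∣X∣≡4 , ∣NX∣≡3)
  bySizes (inj₂ (inj₂ (∣X∣≡5 , ∣NX∣≡4))) = Conclusion-swap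
    (FourThreeSet⇒Conclusion (swap H) (swap-IsSTBigraph H st) (fiveFour-dual H st X ∣X∣≡5 ∣NX∣≡4))

proposition17 : (H : Bigraph 8) → IsSTBigraph 8 3 H → ¬ HasOneFactor H →
    ((Contains Type1 H × Contains Type1 (swap H))
      ⊎ (Contains Type2 H × Contains Type2 (swap H)))
    ⊎ (Contains Type3 H ⊎ Contains Type4 H ⊎ Contains Type3 (swap H) ⊎ Contains Type4 (swap H))
proposition17 H st ¬1F =
  let (X , X-obs) = ¬HasOneFactor⇒obstruction H ¬1F in IsObstruction⇒Conclusion H st X X-obs
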